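{- (a) Let $(G,\sigma)=(\theta(5,3,5),\sigma)$ (whose underlying graph has girth $6$, two cycles of length $6$ and one cycle of length $8$). Then $r(G,\sigma)=6$ if and only if both cycles of length $6$ in $(G,\sigma)$ are unbalanced (negative). Let $(G,\sigma)=(\theta(5,5,5),\sigma)$ (girth $8$). Then $r(G,\sigma)=8$ if and only if $(G,\sigma)$ is balanced. (b) Let $T_1$ be the graph with vertex set $\{c_1,\dots,c_6,x,y_1,y_2,y_3\}$ whose edges are those of the $6$-cycle $c_1c_2c_3c_4c_5c_6c_1$ together with $xy_1,xy_2,xy_3$ and $y_1c_1,y_2c_3,y_3c_5$ (a tricyclic graph of girth $6$). For a signed graph $(T_1,\sigma)$, $r(T_1,\sigma)=6$ if and only if all cycles of length $6$ in $(T_1,\sigma)$ are unbalanced (negative).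
   Context: For integers $p,l,q\geq 2$ with at most one equal to $2$, $\theta(p,l,q)$ is the graph obtained from three paths with $p$, $l$, $q$ vertices by identifying their three initial vertices into one vertex and their three terminal vertices into one vertex. A signed graph $(G,\sigma)$ is a simple graph with $\sigma:E(G)\to\{+,-\}$; its adjacency matrix has $(i,j)$-entry $\sigma(v_iv_j)$ for edges and $0$ otherwise, and $r(G,\sigma)$ is its rank. A cycle is positive (balanced) if the product of its edge signs is $+$, negative (unbalanced) otherwise; a signed graph is balanced if all its cycles are positive. -}

module Defs where

open import Data.Nat using (ℕ; zero; suc; _≤_)
open import Data.Fin using (Fin; zero; suc; #_; inject₁; fromℕ)
import Data.Fin as Fin
open import Data.Vec using (Vec; []; _∷_)
open import Data.List using (List; []; _∷_; _++_; tabulate)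
open import Data.Product using (Σ; _×_; _,_)
open import Data.Maybe using (Maybe; just; nothing)
open import Data.Bool using (Bool; true; false; _∧_; _∨_; if_then_else_)
open import Data.Rational using (ℚ; 0ℚ; 1ℚ; -_; _+_; _*_)
open import Relation.Nullary using (¬_)
open import Relation.Nullary.Decidable using (⌊_⌋)
open import Relation.Binary.PropositionalEquality using (_≡_)
open import Function.Definitions using (Injective)

data Sign : Set where
  pos neg : Sign

_·_ : Sign → Sign → Sign
pos · s = s
neg · pos = neg
neg · neg = pos

signℚ : Sign → ℚ
signℚ pos = 1ℚ
signℚ neg = - 1ℚ

-- A simple graph on vertex set Fin n is given by a vector of its m edges
-- (unordered pairs, each listed once, no loops).  A signature is a map
-- σ : Fin m → Sign on the edges.

EdgeList : ℕ → ℕ → Set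
EdgeList n m = Vec (Fin n × Fin n) m

findEdge : ∀ {n m} → EdgeList n m → Fin n → Fin n → Maybe (Fin m)
findEdge [] i j = nothing
findEdge ((a , b) ∷ es) i j =
  if (⌊ a Fin.≟ i ⌋ ∧ ⌊ b Fin.≟ j ⌋) ∨ (⌊ a Fin.≟ j ⌋ ∧ ⌊ b Fin.≟ i ⌋)
  then just zero
  else Data.Maybe.map suc (findEdge es i j)
  where import Data.Maybe

adjMatrix : ∀ {n m} → EdgeList n m → (Fin m → Sign) → Fin n → Fin n → ℚ
adjMatrix E σ i j with findEdge E i j
... | just e  = signℚ (σ e)
... | nothing = 0ℚ

-- Rank over ℚ (= rank over ℝ for a rational matrix): the maximal number
-- of linearly independent rows.

sumFin : ∀ k → (Fin k → ℚ) → ℚ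
sumFin zero f = 0ℚ
sumFin (suc k) f = f zero + sumFin k (λ t → f (suc t))

RowsIndependent : ∀ {n k} → (Fin n → Fin n → ℚ) → (Fin k → Fin n) → Set
RowsIndependent {n} {k} A r =
  (c : Fin k → ℚ) →
  (∀ j → sumFin k (λ t → c t * A (r t) j) ≡ 0ℚ) →
  ∀ t → c t ≡ 0ℚ

HasRank : ∀ {n} → (Fin n → Fin n → ℚ) → ℕ → Set
HasRank {n} A k =
  Σ (Fin k → Fin n) (λ r → Injective _≡_ _≡_ r × RowsIndependent A r)
  × ((r : Fin (suc k) → Fin n) → Injective _≡_ _≡_ r → ¬ RowsIndependent A r)

walkSign : ∀ {n m} → EdgeList n m → (Fin m → Sign) → List (Fin n × Fin n) → Maybe Sign
walkSign E σ [] = just pos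
walkSign E σ ((i , j) ∷ ps) with findEdge E i j | walkSign E σ ps
... | just e  | just s = just (σ e · s)
... | _       | _      = nothing

closedWalkSign : ∀ {n m k} → EdgeList n m → (Fin m → Sign) → (Fin k → Fin n) → Maybe Sign
closedWalkSign {k = zero} E σ f = nothing
closedWalkSign {k = suc k} E σ f =
  walkSign E σ (tabulate (λ (t : Fin k) → (f (inject₁ t) , f (suc t)))
                ++ ((f (fromℕ k) , f zero) ∷ []))

-- f : Fin k → Fin n traces a cycle of length k (k ≥ 3, distinct vertices,
-- consecutive ones adjacent, last adjacent to first) whose sign is s
IsCycleWithSign : ∀ {n m} → EdgeList n m → (Fin m → Sign) →
                  (k : ℕ) → (Fin k → Fin n) → Sign → Set
IsCycleWithSign E σ k f s =
  3 ≤ k × Injective _≡_ _≡_ f × closedWalkSign E σ f ≡ just s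

AllCyclesOfLengthNegative : ∀ {n m} → EdgeList n m → (Fin m → Sign) → ℕ → Set
AllCyclesOfLengthNegative {n} E σ k =
  (f : Fin k → Fin n) (s : Sign) → IsCycleWithSign E σ k f s → s ≡ neg

Balanced : ∀ {n m} → EdgeList n m → (Fin m → Sign) → Set
Balanced {n} E σ =
  (k : ℕ) (f : Fin k → Fin n) (s : Sign) → IsCycleWithSign E σ k f s → s ≡ pos

-- θ(5,3,5): end vertices 0 and 1; paths 0-2-3-4-1, 0-5-1, 0-6-7-8-1
theta535 : EdgeList 9 10
theta535 =
  (# 0 , # 2) ∷ (# 2 , # 3) ∷ (# 3 , # 4) ∷ (# 4 , # 1) ∷
  (# 0 , # 5) ∷ (# 5 , # 1) ∷
  (# 0 , # 6) ∷ (# 6 , # 7) ∷ (# 7 , # 8) ∷ (# 8 , # 1) ∷ []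

-- θ(5,5,5): end vertices 0 and 1; paths 0-2-3-4-1, 0-5-6-7-1, 0-8-9-10-1
theta555 : EdgeList 11 12
theta555 =
  (# 0 , # 2) ∷ (# 2 , # 3) ∷ (# 3 , # 4) ∷ (# 4 , # 1) ∷
  (# 0 , # 5) ∷ (# 5 , # 6) ∷ (# 6 , # 7) ∷ (# 7 , # 1) ∷
  (# 0 , # 8) ∷ (# 8 , # 9) ∷ (# 9 , # 10) ∷ (# 10 , # 1) ∷ []

-- T₁: c₁,…,c₆ = 0,…,5 ; x = 6 ; y₁,y₂,y₃ = 7,8,9
T1 : EdgeList 10 12
T1 =
  (# 0 , # 1) ∷ (# 1 , # 2) ∷ (# 2 , # 3) ∷ (# 3 , # 4) ∷ (# 4 , # 5) ∷ (# 5 , # 0) ∷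
  (# 6 , # 7) ∷ (# 6 , # 8) ∷ (# 6 , # 9) ∷
  (# 7 , # 0) ∷ (# 8 , # 2) ∷ (# 9 , # 4) ∷ []

-- Switching a signature by a vertex signing d : V → {±} (τ(uv) = d(u) σ(uv) d(v)) conjugates the signed
-- adjacency matrix by the diagonal ±1 matrix of d, so it preserves the rank, and it preserves the sign of
-- every cycle. Switching along a rooted spanning tree makes every tree edge positive, so each signature
-- of θ(5,3,5), θ(5,5,5) and T₁ is equivalent to one of 4, 4 and 8 normal forms, given by the signs of the
-- non-tree edges. For each normal form A the rank is certified by rational matrices: a right inverse of
-- the rows R of A (A_R Y = I) makes these rows independent, and writing every row of A as a combination
-- of the rows R bounds the rank from above, since k+1 vectors in the span of k vectors are dependent.
-- The cycle conditions are refuted by an explicit cycle or verified by enumerating closed walks.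
module Submission where

open import Defs
open import Algebra.Bundles using (CommutativeRing)
open import Data.Bool using (true; false; _∧_; _∨_; T)
open import Data.Empty using (⊥-elim)
open import Data.Fin using (Fin; zero; suc; #_; inject₁; fromℕ)
import Data.Fin as Fin
open import Data.Fin.Permutation.Components using (transpose; transpose-inverse)
open import Data.Fin.Properties using (all?; ¬∀⟶∃¬)
open import Data.List using (List; []; _∷_; _++_; _∷ʳ_)
import Data.List as List
import Data.List.Properties as Listₚ
open import Data.List.Relation.Unary.Unique.Propositional using (Unique)
import Data.List.Relation.Unary.Unique.Propositional.Properties as Uniqueₚ
open import Data.List.Relation.Unary.Unique.DecPropositional using (unique?)
open import Data.Maybe using (Maybe; just; nothing; is-just)
import Data.Maybe as Maybe
import Data.Maybe.Properties as Maybeₚ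
open import Data.Nat using (ℕ; zero; suc)
import Data.Nat.Properties as ℕₚ
open import Data.Product using (Σ; ∃; _×_; _,_; proj₁; proj₂)
open import Data.Rational using (ℚ; 0ℚ; 1ℚ; ½; -½; -_; _+_; _-_; _*_; 1/_; ≢-nonZero)
open import Data.Rational.Properties
  using (_≟_; +-*-commutativeRing; *-inverseˡ; *-assoc; *-zeroˡ; *-zeroʳ; *-identityʳ;
         +-identityˡ; +-identityʳ)
open import Data.Rational.Solver using (module +-*-Solver)
open import Data.Sum using (_⊎_; inj₁; inj₂)
open import Data.Vec using (Vec; []; _∷_; lookup)
import Data.Vec as Vec
open import Data.Vec.Properties using (lookup∘tabulate; lookup-replicate)
open import Function.Base using (_∘_)
open import Function.Bundles using (_⇔_; mk⇔; Equivalence)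
open import Function.Definitions using (Injective)
open import Function.Properties.Equivalence using () renaming (trans to ⇔-trans; sym to ⇔-sym)
open import Relation.Binary.Definitions using (DecidableEquality)
open import Relation.Binary.PropositionalEquality
open import Relation.Nullary using (¬_; Dec; yes; no)
open import Relation.Nullary.Decidable using (⌊_⌋; True; toWitness; T?; map′; _→-dec_; _×-dec_; ¬?)

open CommutativeRing +-*-commutativeRing using (semiring)
open import Algebra.Properties.Semiring.Sum semiring
  using (sum; sum-syntax; sum-cong-≗; sum-replicate-zero; ∑-distrib-+; ∑-comm;
         *-distribˡ-sum; *-distribʳ-sum)
open +-*-Solver using (solve; _:+_; _:*_; :-_; _:=_; con)
open ≡-Reasoning

Matrix : ℕ → ℕ → Set
Matrix l k = Fin l → Fin k → ℚ

sumFin≡sum : ∀ k (f : Fin k → ℚ) → sumFin k f ≡ sum f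
sumFin≡sum zero    f = refl
sumFin≡sum (suc k) f = cong (f zero +_) (sumFin≡sum k (λ t → f (suc t)))

∑-zero : ∀ k {f : Fin k → ℚ} → (∀ t → f t ≡ 0ℚ) → ∑[ t < k ] f t ≡ 0ℚ
∑-zero k f≡0 = trans (sum-cong-≗ f≡0) (sum-replicate-zero k)

∑∑-assoc : ∀ {l k} (c : Fin l → ℚ) (F : Matrix l k) (G : Fin k → ℚ) →
  ∑[ t < l ] (c t * ∑[ j < k ] (F t j * G j)) ≡ ∑[ j < k ] (∑[ t < l ] (c t * F t j) * G j)
∑∑-assoc {l} {k} c F G = begin
  ∑[ t < l ] (c t * ∑[ j < k ] (F t j * G j))
    ≡⟨ sum-cong-≗ (λ t → *-distribˡ-sum (c t) (λ j → F t j * G j)) ⟩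
  ∑[ t < l ] ∑[ j < k ] (c t * (F t j * G j))
    ≡⟨ ∑-comm (λ t j → c t * (F t j * G j)) ⟩
  ∑[ j < k ] ∑[ t < l ] (c t * (F t j * G j))
    ≡⟨ sum-cong-≗ (λ j → sum-cong-≗ (λ t → sym (*-assoc (c t) (F t j) (G j)))) ⟩
  ∑[ j < k ] ∑[ t < l ] (c t * F t j * G j)
    ≡⟨ sum-cong-≗ (λ j → sym (*-distribʳ-sum (G j) (λ t → c t * F t j))) ⟩
  ∑[ j < k ] (∑[ t < l ] (c t * F t j) * G j) ∎

RowsDependent : ∀ {l k} → Matrix l k → Set
RowsDependent {l} {k} M =
  Σ (Fin l → ℚ) λ c → (∃ λ t → c t ≢ 0ℚ) × (∀ i → ∑[ t < l ] (c t * M t i) ≡ 0ℚ)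

rowsDependent-reindexColumns : ∀ {l k} {M : Matrix l k} (π ρ : Fin k → Fin k) →
  (∀ i → π (ρ i) ≡ i) → RowsDependent (λ t i → M t (π i)) → RowsDependent M
rowsDependent-reindexColumns {M = M} π ρ πρ≡id (c , c≢0 , rel) =
  c , c≢0 , λ i → subst (λ i′ → ∑[ t < _ ] (c t * M t i′) ≡ 0ℚ) (πρ≡id i) (rel (ρ i))

module _ {k} (M : Matrix (suc (suc k)) (suc k)) (pivot≢0 : M zero zero ≢ 0ℚ) where

  private
    instance
      pivot-nonZero = ≢-nonZero pivot≢0

    pivot = M zero zero

    factor : Fin (suc k) → ℚ
    factor t = M (suc t) zero * 1/ pivot

  eliminated : Matrix (suc k) k
  eliminated t i = M (suc t) (suc i) - factor t * M zero (suc i)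

  private

    column₀ : ∀ t → M (suc t) zero ≡ factor t * pivot
    column₀ t = begin
      M (suc t) zero                    ≡⟨ solve 1 (λ x → x := x :* con 1ℚ) refl (M (suc t) zero) ⟩
      M (suc t) zero * 1ℚ               ≡⟨ cong (M (suc t) zero *_) (sym (*-inverseˡ pivot)) ⟩
      M (suc t) zero * (1/ pivot * pivot) ≡⟨ sym (*-assoc (M (suc t) zero) (1/ pivot) pivot) ⟩
      factor t * pivot                  ∎

  rowsDependent-eliminate : RowsDependent eliminated → RowsDependent M
  rowsDependent-eliminate (d , (t₀ , d≢0) , d-rel) = c , (suc t₀ , d≢0) , rel
    where
      S = ∑[ t < suc k ] (d t * factor t)

      c : Fin (suc (suc k)) → ℚ
      c zero    = - S
      c (suc t) = d t

      ∑d*factor* : ∀ x → ∑[ t < suc k ] (d t * (factor t * x)) ≡ S * x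
      ∑d*factor* x = trans (sum-cong-≗ (λ t → sym (*-assoc (d t) (factor t) x)))
                           (sym (*-distribʳ-sum x (λ t → d t * factor t)))

      rel : ∀ i → ∑[ t < suc (suc k) ] (c t * M t i) ≡ 0ℚ
      rel zero = begin
        - S * pivot + ∑[ t < suc k ] (d t * M (suc t) zero)
          ≡⟨ cong (- S * pivot +_)
               (trans (sum-cong-≗ (λ t → cong (d t *_) (column₀ t))) (∑d*factor* pivot)) ⟩
        - S * pivot + S * pivot
          ≡⟨ solve 2 (λ s m → :- s :* m :+ s :* m := con 0ℚ) refl S pivot ⟩
        0ℚ ∎
      rel (suc i) = begin
        - S * m + ∑[ t < suc k ] (d t * M (suc t) (suc i))
          ≡⟨ cong (- S * m +_) (sum-cong-≗ λ t →
               solve 4 (λ d x f m → d :* x := d :* (x :+ :- (f :* m)) :+ d :* (f :* m))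
                 refl (d t) (M (suc t) (suc i)) (factor t) m) ⟩
        - S * m + ∑[ t < suc k ] (d t * eliminated t i + d t * (factor t * m))
          ≡⟨ cong (- S * m +_) (∑-distrib-+ (λ t → d t * eliminated t i) (λ t → d t * (factor t * m))) ⟩
        - S * m + (∑[ t < suc k ] (d t * eliminated t i) + ∑[ t < suc k ] (d t * (factor t * m)))
          ≡⟨ cong₂ (λ a b → - S * m + (a + b)) (d-rel i) (∑d*factor* m) ⟩
        - S * m + (0ℚ + S * m)
          ≡⟨ solve 2 (λ s m → :- s :* m :+ (con 0ℚ :+ s :* m) := con 0ℚ) refl S m ⟩
        0ℚ ∎
        where m = M zero (suc i)

rowsDependent : ∀ k (M : Matrix (suc k) k) → RowsDependent M
rowsDependent zero M = (λ _ → 1ℚ) , (zero , λ ()) , λ ()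
rowsDependent (suc k) M with all? (λ i → M zero i ≟ 0ℚ)
... | yes row₀≡0 = c , (zero , λ ()) , rel
  where
    c : Fin (suc (suc k)) → ℚ
    c zero    = 1ℚ
    c (suc t) = 0ℚ

    rel : ∀ i → ∑[ t < suc (suc k) ] (c t * M t i) ≡ 0ℚ
    rel i = trans (cong₂ _+_ (solve 1 (λ x → con 1ℚ :* x := x) refl (M zero i))
                             (∑-zero (suc k) (λ t → *-zeroˡ (M (suc t) i))))
                  (trans (+-identityʳ (M zero i)) (row₀≡0 i))
... | no row₀≢0 with ¬∀⟶∃¬ _ _ (λ i → M zero i ≟ 0ℚ) row₀≢0
... | j , M₀ⱼ≢0 =
  rowsDependent-reindexColumns {M = M} (transpose zero j) (transpose j zero) (λ _ → transpose-inverse zero j)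
    (rowsDependent-eliminate M′ M₀ⱼ≢0 (rowsDependent k (eliminated M′ M₀ⱼ≢0)))
  where
    M′ : Matrix (suc (suc k)) (suc k)
    M′ t i = M t (transpose zero j i)

idMatrix : ∀ {k} → Matrix k k
idMatrix zero    zero    = 1ℚ
idMatrix zero    (suc _) = 0ℚ
idMatrix (suc _) zero    = 0ℚ
idMatrix (suc t) (suc u) = idMatrix t u

idMatrix-diagonal : ∀ {k} (t : Fin k) → idMatrix t t ≡ 1ℚ
idMatrix-diagonal zero    = refl
idMatrix-diagonal (suc t) = idMatrix-diagonal t

idMatrix≡1⇒≡ : ∀ {k} (t u : Fin k) → idMatrix t u ≡ 1ℚ → t ≡ u
idMatrix≡1⇒≡ zero    zero    _    = refl
idMatrix≡1⇒≡ (suc t) (suc u) δ≡1 = cong suc (idMatrix≡1⇒≡ t u δ≡1)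

∑-idMatrix : ∀ k (c : Fin k → ℚ) u → ∑[ t < k ] (c t * idMatrix t u) ≡ c u
∑-idMatrix (suc k) c zero = begin
  c zero * 1ℚ + ∑[ t < k ] (c (suc t) * 0ℚ)
    ≡⟨ cong₂ _+_ (*-identityʳ (c zero)) (∑-zero k (λ t → *-zeroʳ (c (suc t)))) ⟩
  c zero + 0ℚ
    ≡⟨ +-identityʳ (c zero) ⟩
  c zero ∎
∑-idMatrix (suc k) c (suc u) = begin
  c zero * 0ℚ + ∑[ t < k ] (c (suc t) * idMatrix t u)
    ≡⟨ cong₂ _+_ (*-zeroʳ (c zero)) (∑-idMatrix k (λ t → c (suc t)) u) ⟩
  0ℚ + c (suc u)
    ≡⟨ +-identityˡ (c (suc u)) ⟩
  c (suc u) ∎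

∑-*-zeroˡ : ∀ k (G : Fin k → ℚ) → ∑[ j < k ] (0ℚ * G j) ≡ 0ℚ
∑-*-zeroˡ k G = ∑-zero k (λ j → *-zeroˡ (G j))

module _ {n} (A : Matrix n n) where

  IsRightInverseOnRows : ∀ {k} → (Fin k → Fin n) → Matrix n k → Set
  IsRightInverseOnRows {k} r Y = ∀ t u → ∑[ j < n ] (A (r t) j * Y j u) ≡ idMatrix t u

  isRightInverseOnRows? : ∀ {k} (r : Fin k → Fin n) (Y : Matrix n k) → Dec (IsRightInverseOnRows r Y)
  isRightInverseOnRows? r Y = all? λ t → all? λ u → ∑[ j < n ] (A (r t) j * Y j u) ≟ idMatrix t u

  IsSpannedByRows : ∀ {k} → (Fin k → Fin n) → Matrix n k → Set
  IsSpannedByRows {k} r X = ∀ v j → A v j ≡ ∑[ i < k ] (X v i * A (r i) j)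

  isSpannedByRows? : ∀ {k} (r : Fin k → Fin n) (X : Matrix n k) → Dec (IsSpannedByRows r X)
  isSpannedByRows? {k} r X = all? λ v → all? λ j → A v j ≟ ∑[ i < k ] (X v i * A (r i) j)

  rowsIndependent-rightInverse : ∀ {k} {r : Fin k → Fin n} {Y : Matrix n k} →
    IsRightInverseOnRows r Y → RowsIndependent A r
  rowsIndependent-rightInverse {k} {r} {Y} AY≡I c c-rel u = begin
    c u
      ≡⟨ sym (∑-idMatrix k c u) ⟩
    ∑[ t < k ] (c t * idMatrix t u)
      ≡⟨ sum-cong-≗ (λ t → cong (c t *_) (sym (AY≡I t u))) ⟩
    ∑[ t < k ] (c t * ∑[ j < n ] (A (r t) j * Y j u))
      ≡⟨ ∑∑-assoc c (λ t → A (r t)) (λ j → Y j u) ⟩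
    ∑[ j < n ] (∑[ t < k ] (c t * A (r t) j) * Y j u)
      ≡⟨ sum-cong-≗ (λ j → cong (_* Y j u) (trans (sym (sumFin≡sum k _)) (c-rel j))) ⟩
    ∑[ j < n ] (0ℚ * Y j u)
      ≡⟨ ∑-*-zeroˡ n (λ j → Y j u) ⟩
    0ℚ ∎

  injective-rightInverse : ∀ {k} {r : Fin k → Fin n} {Y : Matrix n k} →
    IsRightInverseOnRows r Y → Injective _≡_ _≡_ r
  injective-rightInverse {r = r} {Y} AY≡I {t} {t′} rₜ≡rₜ′ =
    sym (idMatrix≡1⇒≡ t′ t (begin
      idMatrix t′ t                         ≡⟨ sym (AY≡I t′ t) ⟩
      ∑[ j < n ] (A (r t′) j * Y j t)       ≡⟨ cong (λ v → ∑[ j < n ] (A v j * Y j t)) (sym rₜ≡rₜ′) ⟩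
      ∑[ j < n ] (A (r t) j * Y j t)        ≡⟨ AY≡I t t ⟩
      idMatrix t t                          ≡⟨ idMatrix-diagonal t ⟩
      1ℚ                                    ∎))

  ¬rowsIndependent-span : ∀ {k} (W : Matrix k n) (X : Matrix n k) →
    (∀ v j → A v j ≡ ∑[ i < k ] (X v i * W i j)) → (r : Fin (suc k) → Fin n) → ¬ RowsIndependent A r
  ¬rowsIndependent-span {k} W X A≡XW r independent with rowsDependent k (λ t → X (r t))
  ... | c , (t₀ , cₜ₀≢0) , c-rel = cₜ₀≢0 (independent c c-rel′ t₀)
    where
      c-rel′ : ∀ j → sumFin (suc k) (λ t → c t * A (r t) j) ≡ 0ℚ
      c-rel′ j = begin
        sumFin (suc k) (λ t → c t * A (r t) j)
          ≡⟨ sumFin≡sum (suc k) (λ t → c t * A (r t) j) ⟩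
        ∑[ t < suc k ] (c t * A (r t) j)
          ≡⟨ sum-cong-≗ (λ t → cong (c t *_) (A≡XW (r t) j)) ⟩
        ∑[ t < suc k ] (c t * ∑[ i < k ] (X (r t) i * W i j))
          ≡⟨ ∑∑-assoc c (λ t → X (r t)) (λ i → W i j) ⟩
        ∑[ i < k ] (∑[ t < suc k ] (c t * X (r t) i) * W i j)
          ≡⟨ sum-cong-≗ (λ i → cong (_* W i j) (c-rel i)) ⟩
        ∑[ i < k ] (0ℚ * W i j)
          ≡⟨ ∑-*-zeroˡ k (λ i → W i j) ⟩
        0ℚ ∎

  hasRank-by : ∀ {k} (r : Fin k → Fin n) (Y X : Matrix n k) →
    {True (isRightInverseOnRows? r Y)} → {True (isSpannedByRows? r X)} → HasRank A k
  hasRank-by r Y X {AY≡I} {A≡XA} =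
    (r , injective-rightInverse (toWitness AY≡I) , rowsIndependent-rightInverse (toWitness AY≡I)) ,
    λ r′ _ → ¬rowsIndependent-span (λ i → A (r i)) X (toWitness A≡XA) r′

  ¬hasRank-by : ∀ {k} (r : Fin (suc k) → Fin n) (Y : Matrix n (suc k)) →
    {True (isRightInverseOnRows? r Y)} → ¬ HasRank A k
  ¬hasRank-by r Y {AY≡I} (_ , no-k+1-independent) =
    no-k+1-independent r (injective-rightInverse (toWitness AY≡I))
                         (rowsIndependent-rightInverse (toWitness AY≡I))

module _ {n} {A B : Matrix n n} {s : Fin n → ℚ}
         (s²≡1 : ∀ i → s i * s i ≡ 1ℚ) (B≡sAs : ∀ i j → B i j ≡ s i * A i j * s j) where

  private
    *-s² : ∀ x i → x ≡ x * s i * s i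
    *-s² x i = begin
      x                 ≡⟨ sym (*-identityʳ x) ⟩
      x * 1ℚ            ≡⟨ cong (x *_) (sym (s²≡1 i)) ⟩
      x * (s i * s i)   ≡⟨ sym (*-assoc x (s i) (s i)) ⟩
      x * s i * s i     ∎

  conjugate-involutive : ∀ i j → A i j ≡ s i * B i j * s j
  conjugate-involutive i j = begin
    A i j
      ≡⟨ *-s² (A i j) j ⟩
    A i j * s j * s j
      ≡⟨ cong (λ x → x * s j * s j) (solve 1 (λ a → a := con 1ℚ :* a) refl (A i j)) ⟩
    1ℚ * A i j * s j * s j
      ≡⟨ cong (λ x → x * A i j * s j * s j) (sym (s²≡1 i)) ⟩
    s i * s i * A i j * s j * s j
      ≡⟨ solve 4 (λ x y a z → x :* y :* a :* z :* z := x :* (y :* a :* z) :* z)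
           refl (s i) (s i) (A i j) (s j) ⟩
    s i * (s i * A i j * s j) * s j
      ≡⟨ cong (λ b → s i * b * s j) (sym (B≡sAs i j)) ⟩
    s i * B i j * s j ∎

  rowsIndependent-conjugate : ∀ {k} {r : Fin k → Fin n} → RowsIndependent A r → RowsIndependent B r
  rowsIndependent-conjugate {k} {r} independent c c-rel t = begin
    c t                       ≡⟨ *-s² (c t) (r t) ⟩
    c t * s (r t) * s (r t)   ≡⟨ cong (_* s (r t)) (independent (λ t → c t * s (r t)) c′-rel t) ⟩
    0ℚ * s (r t)              ≡⟨ *-zeroˡ (s (r t)) ⟩
    0ℚ                        ∎
    where
      term : ∀ j t → c t * s (r t) * A (r t) j ≡ c t * B (r t) j * s j
      term j t = begin
        c t * s (r t) * A (r t) j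
          ≡⟨ *-s² _ j ⟩
        c t * s (r t) * A (r t) j * s j * s j
          ≡⟨ solve 4 (λ c x a y → c :* x :* a :* y :* y := c :* (x :* a :* y) :* y)
               refl (c t) (s (r t)) (A (r t) j) (s j) ⟩
        c t * (s (r t) * A (r t) j * s j) * s j
          ≡⟨ cong (λ b → c t * b * s j) (sym (B≡sAs (r t) j)) ⟩
        c t * B (r t) j * s j ∎

      c′-rel : ∀ j → sumFin k (λ t → c t * s (r t) * A (r t) j) ≡ 0ℚ
      c′-rel j = begin
        sumFin k (λ t → c t * s (r t) * A (r t) j)
          ≡⟨ sumFin≡sum k (λ t → c t * s (r t) * A (r t) j) ⟩
        ∑[ t < k ] (c t * s (r t) * A (r t) j)
          ≡⟨ sum-cong-≗ (term j) ⟩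
        ∑[ t < k ] (c t * B (r t) j * s j)
          ≡⟨ sym (*-distribʳ-sum (s j) (λ t → c t * B (r t) j)) ⟩
        ∑[ t < k ] (c t * B (r t) j) * s j
          ≡⟨ cong (_* s j) (trans (sym (sumFin≡sum k (λ t → c t * B (r t) j))) (c-rel j)) ⟩
        0ℚ * s j
          ≡⟨ *-zeroˡ (s j) ⟩
        0ℚ ∎

hasRank-transfer : ∀ {n k} {A B : Matrix n n} →
  (∀ {l} {r : Fin l → Fin n} → RowsIndependent A r → RowsIndependent B r) →
  (∀ {l} {r : Fin l → Fin n} → RowsIndependent B r → RowsIndependent A r) →
  HasRank A k → HasRank B k
hasRank-transfer A⇒B B⇒A ((r , r-inj , independent) , ¬independent) =
  (r , r-inj , A⇒B {r = r} independent) , λ r′ r′-inj → ¬independent r′ r′-inj ∘ B⇒A {r = r′}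

hasRank-conjugate : ∀ {n k} {A B : Matrix n n} {s : Fin n → ℚ} →
  (∀ i → s i * s i ≡ 1ℚ) → (∀ i j → B i j ≡ s i * A i j * s j) → HasRank A k ⇔ HasRank B k
hasRank-conjugate {A = A} {B} {s} s²≡1 B≡sAs =
  mk⇔ (hasRank-transfer {A = A} {B} A⇒B B⇒A) (hasRank-transfer {A = B} {A} B⇒A A⇒B)
  where
    A⇒B : ∀ {l} {r : Fin l → Fin _} → RowsIndependent A r → RowsIndependent B r
    A⇒B {r = r} = rowsIndependent-conjugate {A = A} {B} {s} s²≡1 B≡sAs {r = r}
    B⇒A : ∀ {l} {r : Fin l → Fin _} → RowsIndependent B r → RowsIndependent A r
    B⇒A {r = r} =
      rowsIndependent-conjugate {A = B} {A} {s} s²≡1 (conjugate-involutive {A = A} {B} {s} s²≡1 B≡sAs) {r = r}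

_≟ˢ_ : DecidableEquality Sign
pos ≟ˢ pos = yes refl
pos ≟ˢ neg = no λ ()
neg ≟ˢ pos = no λ ()
neg ≟ˢ neg = yes refl

·-comm : ∀ a b → a · b ≡ b · a
·-comm pos pos = refl
·-comm pos neg = refl
·-comm neg pos = refl
·-comm neg neg = refl

·-assoc : ∀ a b c → (a · b) · c ≡ a · (b · c)
·-assoc pos b c = refl
·-assoc neg pos c = refl
·-assoc neg neg pos = refl
·-assoc neg neg neg = refl

·-self : ∀ a → a · a ≡ pos
·-self pos = refl
·-self neg = refl

·-cancelˡ : ∀ a b → a · (a · b) ≡ b
·-cancelˡ a b = trans (sym (·-assoc a a b)) (cong (_· b) (·-self a))

·-reverse : ∀ a b c → (a · b) · c ≡ (c · b) · a
·-reverse a b c = begin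
  (a · b) · c  ≡⟨ ·-comm (a · b) c ⟩
  c · (a · b)  ≡⟨ cong (c ·_) (·-comm a b) ⟩
  c · (b · a)  ≡⟨ sym (·-assoc c b a) ⟩
  (c · b) · a  ∎

·-swap : ∀ a b c → a · (b · c) ≡ b · (a · c)
·-swap a b c = begin
  a · (b · c)  ≡⟨ sym (·-assoc a b c) ⟩
  (a · b) · c  ≡⟨ cong (_· c) (·-comm a b) ⟩
  (b · a) · c  ≡⟨ ·-assoc b a c ⟩
  b · (a · c)  ∎

·-square : ∀ a b → (a · b) · (b · a) ≡ pos
·-square a b = trans (cong ((a · b) ·_) (·-comm b a)) (·-self (a · b))

signℚ-· : ∀ a b → signℚ (a · b) ≡ signℚ a * signℚ b
signℚ-· pos pos = refl
signℚ-· pos neg = refl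
signℚ-· neg pos = refl
signℚ-· neg neg = refl

signℚ² : ∀ a → signℚ a * signℚ a ≡ 1ℚ
signℚ² a = trans (sym (signℚ-· a a)) (cong signℚ (·-self a))

findEdge-sound : ∀ {n m} (E : EdgeList n m) {i j} e → findEdge E i j ≡ just e →
  lookup E e ≡ (i , j) ⊎ lookup E e ≡ (j , i)
findEdge-sound ((a , b) ∷ E) {i} {j} e found
  with (⌊ a Fin.≟ i ⌋ ∧ ⌊ b Fin.≟ j ⌋) ∨ (⌊ a Fin.≟ j ⌋ ∧ ⌊ b Fin.≟ i ⌋) in matches
findEdge-sound ((a , b) ∷ E) {i} {j} .zero refl | true = endpoints-match matches
  where
    endpoints-match : (⌊ a Fin.≟ i ⌋ ∧ ⌊ b Fin.≟ j ⌋) ∨ (⌊ a Fin.≟ j ⌋ ∧ ⌊ b Fin.≟ i ⌋) ≡ true →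
      (a , b) ≡ (i , j) ⊎ (a , b) ≡ (j , i)
    endpoints-match with a Fin.≟ i | b Fin.≟ j | a Fin.≟ j | b Fin.≟ i
    ... | yes refl | yes refl | _        | _        = λ _ → inj₁ refl
    ... | yes _    | no _     | yes refl | yes refl = λ _ → inj₂ refl
    ... | no _     | _        | yes refl | yes refl = λ _ → inj₂ refl
    ... | yes _    | no _     | no _     | _        = λ ()
    ... | yes _    | no _     | yes _    | no _     = λ ()
    ... | no _     | _        | no _     | _        = λ ()
    ... | no _     | _        | yes _    | no _     = λ ()
findEdge-sound ((a , b) ∷ E) {i} {j} e found | false with findEdge E i j in found′
findEdge-sound ((a , b) ∷ E) .(suc e′) refl | false | just e′ = findEdge-sound E e′ found′

steps : ∀ {n} → Fin n → List (Fin n) → List (Fin n × Fin n)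
steps x []       = []
steps x (y ∷ ys) = (x , y) ∷ steps y ys

endpoint : ∀ {n} → Fin n → List (Fin n) → Fin n
endpoint x []       = x
endpoint x (y ∷ ys) = endpoint y ys

endpoint-∷ʳ : ∀ {n} (x : Fin n) ys z → endpoint x (ys ∷ʳ z) ≡ z
endpoint-∷ʳ x []       z = refl
endpoint-∷ʳ x (y ∷ ys) z = endpoint-∷ʳ y ys z

closedWalk-steps : ∀ {n k} (f : Fin (suc k) → Fin n) z →
  List.tabulate (λ (t : Fin k) → (f (inject₁ t) , f (suc t))) ++ (f (fromℕ k) , z) ∷ [] ≡
  steps (f zero) (List.tabulate (f ∘ suc) ∷ʳ z)
closedWalk-steps {k = zero}  f z = refl
closedWalk-steps {k = suc k} f z = cong ((f zero , f (suc zero)) ∷_) (closedWalk-steps (f ∘ suc) z)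

closedWalkSign-steps : ∀ {n m k} (E : EdgeList n m) σ (f : Fin (suc k) → Fin n) →
  closedWalkSign E σ f ≡ walkSign E σ (steps (f zero) (List.tabulate (f ∘ suc) ∷ʳ f zero))
closedWalkSign-steps E σ f = cong (walkSign E σ) (closedWalk-steps f (f zero))

record Switches {n m} (E : EdgeList n m) (d : Fin n → Sign) (σ τ : Fin m → Sign) : Set where
  field
    edgeSign : ∀ e → τ e ≡ (d (proj₁ (lookup E e)) · σ e) · d (proj₂ (lookup E e))

module _ {n m} {E : EdgeList n m} {d : Fin n → Sign} {σ τ : Fin m → Sign}
         (switches : Switches E d σ τ) where

  open Switches switches

  edgeSign-switch : ∀ {i j e} → findEdge E i j ≡ just e → τ e ≡ (d i · σ e) · d j
  edgeSign-switch {i} {j} {e} found with lookup E e | findEdge-sound E e found | edgeSign e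
  ... | _ | inj₁ refl | τₑ = τₑ
  ... | _ | inj₂ refl | τₑ = trans τₑ (·-reverse (d j) (σ e) (d i))

  adjMatrix-switch : ∀ i j → adjMatrix E τ i j ≡ signℚ (d i) * adjMatrix E σ i j * signℚ (d j)
  adjMatrix-switch i j with findEdge E i j in found
  ... | just e  = begin
    signℚ (τ e)                              ≡⟨ cong signℚ (edgeSign-switch found) ⟩
    signℚ ((d i · σ e) · d j)                ≡⟨ signℚ-· (d i · σ e) (d j) ⟩
    signℚ (d i · σ e) * signℚ (d j)          ≡⟨ cong (_* signℚ (d j)) (signℚ-· (d i) (σ e)) ⟩
    signℚ (d i) * signℚ (σ e) * signℚ (d j)  ∎
  ... | nothing = solve 2 (λ x y → con 0ℚ := x :* con 0ℚ :* y) refl (signℚ (d i)) (signℚ (d j))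

  -- The potentials of the inner vertices of a walk cancel in pairs.
  walkSign-switch : ∀ x ys →
    walkSign E τ (steps x ys) ≡ Maybe.map ((d x · d (endpoint x ys)) ·_) (walkSign E σ (steps x ys))
  walkSign-switch x [] = cong (λ s → just (s · pos)) (sym (·-self (d x)))
  walkSign-switch x (y ∷ ys)
    with findEdge E x y in found | walkSign E σ (steps y ys) | walkSign E τ (steps y ys) | walkSign-switch y ys
  ... | nothing | _      | _ | _    = refl
  ... | just e  | nothing | _ | refl = refl
  ... | just e  | just s  | _ | refl = cong just (begin
    τ e · ((dy · dz) · s)                ≡⟨ cong (_· ((dy · dz) · s)) (edgeSign-switch found) ⟩
    ((dx · σ e) · dy) · ((dy · dz) · s)  ≡⟨ ·-assoc (dx · σ e) dy ((dy · dz) · s) ⟩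
    (dx · σ e) · (dy · ((dy · dz) · s))  ≡⟨ cong (λ u → (dx · σ e) · (dy · u)) (·-assoc dy dz s) ⟩
    (dx · σ e) · (dy · (dy · (dz · s))) ≡⟨ cong ((dx · σ e) ·_) (·-cancelˡ dy (dz · s)) ⟩
    (dx · σ e) · (dz · s)              ≡⟨ ·-assoc dx (σ e) (dz · s) ⟩
    dx · (σ e · (dz · s))              ≡⟨ cong (dx ·_) (·-swap (σ e) dz s) ⟩
    dx · (dz · (σ e · s))              ≡⟨ sym (·-assoc dx dz (σ e · s)) ⟩
    (dx · dz) · (σ e · s)                ∎)
    where dx = d x; dy = d y; dz = d (endpoint y ys)

  closedWalkSign-switch : ∀ {k} (f : Fin k → Fin n) → closedWalkSign E τ f ≡ closedWalkSign E σ f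
  closedWalkSign-switch {zero}  f = refl
  closedWalkSign-switch {suc k} f = begin
    closedWalkSign E τ f                                    ≡⟨ closedWalkSign-steps E τ f ⟩
    walkSign E τ (steps x ys)                               ≡⟨ walkSign-switch x ys ⟩
    Maybe.map ((d x · d (endpoint x ys)) ·_) (walkSign E σ (steps x ys))
      ≡⟨ cong (λ v → Maybe.map ((d x · d v) ·_) (walkSign E σ (steps x ys))) (endpoint-∷ʳ x inner x) ⟩
    Maybe.map ((d x · d x) ·_) (walkSign E σ (steps x ys))
      ≡⟨ Maybeₚ.map-cong (λ s → cong (_· s) (·-self (d x))) (walkSign E σ (steps x ys)) ⟩
    Maybe.map (pos ·_) (walkSign E σ (steps x ys))
      ≡⟨ Maybeₚ.map-id (walkSign E σ (steps x ys)) ⟩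
    walkSign E σ (steps x ys)
      ≡⟨ sym (closedWalkSign-steps E σ f) ⟩
    closedWalkSign E σ f ∎
    where x = f zero; inner = List.tabulate (f ∘ suc); ys = inner ∷ʳ x

  hasRank-switch : ∀ {k} → HasRank (adjMatrix E σ) k ⇔ HasRank (adjMatrix E τ) k
  hasRank-switch =
    hasRank-conjugate {A = adjMatrix E σ} {s = signℚ ∘ d} (λ i → signℚ² (d i)) adjMatrix-switch

  isCycleWithSign-switch : ∀ {k f s} → IsCycleWithSign E σ k f s ⇔ IsCycleWithSign E τ k f s
  isCycleWithSign-switch {f = f} = mk⇔
    (λ (3≤k , f-inj , sign) → 3≤k , f-inj , trans (closedWalkSign-switch f) sign)
    (λ (3≤k , f-inj , sign) → 3≤k , f-inj , trans (sym (closedWalkSign-switch f)) sign)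

  allCyclesNegative-switch : ∀ {k} → AllCyclesOfLengthNegative E σ k ⇔ AllCyclesOfLengthNegative E τ k
  allCyclesNegative-switch = mk⇔
    (λ negative f s → negative f s ∘ Equivalence.from isCycleWithSign-switch)
    (λ negative f s → negative f s ∘ Equivalence.to isCycleWithSign-switch)

  balanced-switch : Balanced E σ ⇔ Balanced E τ
  balanced-switch = mk⇔
    (λ balanced k f s → balanced k f s ∘ Equivalence.from isCycleWithSign-switch)
    (λ balanced k f s → balanced k f s ∘ Equivalence.to isCycleWithSign-switch)

-- parent v is the edge from the parent of v (its first endpoint) to v, and nothing at the root.
module SpanningTree {n m} (E : EdgeList n m) (parent : Fin n → Maybe (Fin m)) where

  rootPath : Fin n → List (Fin m)
  rootPath = walkUp n
    where
      walkUp : ℕ → Fin n → List (Fin m)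
      walkUp zero       v = []
      walkUp (suc fuel) v with parent v
      ... | nothing = []
      ... | just e  = e ∷ walkUp fuel (proj₁ (lookup E e))

  potential : (Fin m → Sign) → Fin n → Sign
  potential σ v = List.foldr (λ e s → σ e · s) pos (rootPath v)

  IsTreeEdge : Fin m → Set
  IsTreeEdge e = rootPath (proj₂ (lookup E e)) ≡ e ∷ rootPath (proj₁ (lookup E e))

  isTreeEdge? : ∀ e → Dec (IsTreeEdge e)
  isTreeEdge? e = Listₚ.≡-dec Fin._≟_ _ _

  normalise : (Fin m → Sign) → Fin m → Sign
  normalise σ e with isTreeEdge? e
  ... | yes _ = pos
  ... | no  _ = (potential σ (proj₁ (lookup E e)) · σ e) · potential σ (proj₂ (lookup E e))

  normalise-edgeSign : ∀ σ e →
    normalise σ e ≡ (potential σ (proj₁ (lookup E e)) · σ e) · potential σ (proj₂ (lookup E e))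
  normalise-edgeSign σ e with isTreeEdge? e
  ... | no  _         = refl
  ... | yes tree-edge = begin
    pos
      ≡⟨ sym (·-square (potential σ a) (σ e)) ⟩
    (potential σ a · σ e) · (σ e · potential σ a)
      ≡⟨ cong ((potential σ a · σ e) ·_) (sym (cong (List.foldr (λ e s → σ e · s) pos) tree-edge)) ⟩
    (potential σ a · σ e) · potential σ b ∎
    where a = proj₁ (lookup E e); b = proj₂ (lookup E e)

  -- Phrased with tabulations so that, for a concrete graph and normal form, the hypothesis holds by refl.
  normalForm-switches : ∀ σ τ → Vec.tabulate (normalise σ) ≡ Vec.tabulate τ →
    Switches E (potential σ) σ τ
  normalForm-switches σ τ normalise≡τ = record { edgeSign = λ e → begin
    τ e                                    ≡⟨ sym (lookup∘tabulate τ e) ⟩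
    lookup (Vec.tabulate τ) e              ≡⟨ cong (λ v → lookup v e) (sym normalise≡τ) ⟩
    lookup (Vec.tabulate (normalise σ)) e  ≡⟨ lookup∘tabulate (normalise σ) e ⟩
    normalise σ e                          ≡⟨ normalise-edgeSign σ e ⟩
    _                                      ∎ }

AllWalksFrom : ∀ {n m} → EdgeList n m → ℕ → Fin n → (List (Fin n) → Set) → Set
AllWalksFrom E zero    x P = P []
AllWalksFrom E (suc k) x P = ∀ y → T (is-just (findEdge E x y)) → AllWalksFrom E k y (P ∘ (y ∷_))

allWalksFrom? : ∀ {n m} (E : EdgeList n m) k x {P : List (Fin n) → Set} →
  (∀ ys → Dec (P ys)) → Dec (AllWalksFrom E k x P)
allWalksFrom? E zero    x P? = P? []
allWalksFrom? E (suc k) x P? = all? λ y → T? _ →-dec allWalksFrom? E k y (P? ∘ (y ∷_))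

module _ {n m} {E : EdgeList n m} {σ : Fin m → Sign} where

  walkSign-∷ : ∀ {x y ps s} → walkSign E σ ((x , y) ∷ ps) ≡ just s →
    T (is-just (findEdge E x y)) × ∃ λ s′ → walkSign E σ ps ≡ just s′
  walkSign-∷ {x} {y} {ps} walk with findEdge E x y | walkSign E σ ps
  walkSign-∷ refl | just _  | just s′ = _ , s′ , refl
  walkSign-∷ ()   | just _  | nothing
  walkSign-∷ ()   | nothing | _

  allWalksFrom-sound : ∀ {k x P} → AllWalksFrom E k x P →
    ∀ ys zs {s} → List.length ys ≡ k → walkSign E σ (steps x (ys ++ zs)) ≡ just s → P ys
  allWalksFrom-sound {zero}  all []       zs refl walk = all
  allWalksFrom-sound {suc k} all (y ∷ ys) zs length≡ walk with walkSign-∷ {ps = steps y (ys ++ zs)} walk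
  ... | adjacent , _ , walk′ =
    allWalksFrom-sound (all y adjacent) ys zs (ℕₚ.suc-injective length≡) walk′

  walkSign-allPositive : (∀ e → σ e ≡ pos) → ∀ ps {s} → walkSign E σ ps ≡ just s → s ≡ pos
  walkSign-allPositive σ≡pos []             refl = refl
  walkSign-allPositive σ≡pos ((i , j) ∷ ps) walk with findEdge E i j | walkSign E σ ps in rest
  walkSign-allPositive σ≡pos ((i , j) ∷ ps) refl | just e  | just s′ =
    cong₂ _·_ (σ≡pos e) (walkSign-allPositive σ≡pos ps rest)
  walkSign-allPositive σ≡pos ((i , j) ∷ ps) ()   | just _  | nothing
  walkSign-allPositive σ≡pos ((i , j) ∷ ps) ()   | nothing | _

  balanced-allPositive : (∀ e → σ e ≡ pos) → Balanced E σ
  balanced-allPositive σ≡pos (suc k) f s (_ , _ , walk) =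
    walkSign-allPositive σ≡pos (steps (f zero) (List.tabulate (f ∘ suc) ∷ʳ f zero))
      (trans (sym (closedWalkSign-steps E σ f)) walk)

ClosedWalksNegative : ∀ {n m} → EdgeList n m → (Fin m → Sign) → ℕ → Set
ClosedWalksNegative {n} E σ k =
  ∀ x → AllWalksFrom E k x λ ys → Unique (x ∷ ys) → walkSign E σ (steps x (ys ∷ʳ x)) ≢ just pos

closedWalksNegative? : ∀ {n m} (E : EdgeList n m) σ k → Dec (ClosedWalksNegative E σ k)
closedWalksNegative? E σ k = all? λ x → allWalksFrom? E k x λ ys →
  unique? Fin._≟_ (x ∷ ys) →-dec
  ¬? (Maybeₚ.≡-dec _≟ˢ_ (walkSign E σ (steps x (ys ∷ʳ x))) (just pos))

allCyclesNegative-closedWalks : ∀ {n m} {E : EdgeList n m} {σ} {k} →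
  ClosedWalksNegative E σ k → AllCyclesOfLengthNegative E σ (suc k)
allCyclesNegative-closedWalks {E = E} {σ} negative f s (_ , f-inj , sign) = ≢pos⇒neg λ s≡pos →
  allWalksFrom-sound (negative (f zero)) ys (f zero ∷ []) (Listₚ.length-tabulate (f ∘ suc)) walk
    (Uniqueₚ.tabulate⁺ f-inj) (trans walk (cong just s≡pos))
  where
    ys = List.tabulate (f ∘ suc)
    walk = trans (sym (closedWalkSign-steps E σ f)) sign

    ≢pos⇒neg : ∀ {s} → s ≢ pos → s ≡ neg
    ≢pos⇒neg {pos} s≢pos = ⊥-elim (s≢pos refl)
    ≢pos⇒neg {neg} _     = refl

injective? : ∀ {k n} (f : Fin k → Fin n) → Dec (Injective _≡_ _≡_ f)
injective? f = map′ (λ inj {i} {j} → inj i j) (λ inj i j → inj)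
  (all? λ i → all? λ j → f i Fin.≟ f j →-dec i Fin.≟ j)

isCycleWithSign? : ∀ {n m} (E : EdgeList n m) σ k (f : Fin k → Fin n) s →
  Dec (IsCycleWithSign E σ k f s)
isCycleWithSign? E σ k f s =
  3 ℕₚ.≤? k ×-dec injective? f ×-dec Maybeₚ.≡-dec _≟ˢ_ (closedWalkSign E σ f) (just s)

module _ {n m} (E : EdgeList n m) (σ : Fin m → Sign) where

  ¬allCyclesNegative-by : ∀ {k} (f : Fin k → Fin n) → {True (isCycleWithSign? E σ k f pos)} →
    ¬ AllCyclesOfLengthNegative E σ k
  ¬allCyclesNegative-by f {cycle} negative with negative f pos (toWitness cycle)
  ... | ()

  ¬balanced-by : ∀ {k} (f : Fin k → Fin n) → {True (isCycleWithSign? E σ k f neg)} → ¬ Balanced E σ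
  ¬balanced-by {k} f {cycle} balanced with balanced k f neg (toWitness cycle)
  ... | ()

  allCyclesNegative-by : ∀ {k} → {True (closedWalksNegative? E σ k)} →
    AllCyclesOfLengthNegative E σ (suc k)
  allCyclesNegative-by {k} {negative} = allCyclesNegative-closedWalks (toWitness negative)

⇔-both-false : ∀ {a b} {A : Set a} {B : Set b} → ¬ A → ¬ B → A ⇔ B
⇔-both-false ¬a ¬b = mk⇔ (⊥-elim ∘ ¬a) (⊥-elim ∘ ¬b)

-1ℚ : ℚ
-1ℚ = - 1ℚ

matrix : ∀ {l k} → Vec (Vec ℚ k) l → Matrix l k
matrix rows i j = lookup (lookup rows i) j

module Theta535 where

  parent : Fin 9 → Maybe (Fin 10)
  parent = lookup
    ( nothing ∷ just (# 3) ∷ just (# 0) ∷ just (# 1) ∷ just (# 2) ∷ just (# 4) ∷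
      just (# 6) ∷ just (# 7) ∷ just (# 8) ∷ [])

  -- p and q are the signs of the cycles 0 2 3 4 1 5 and 0 2 3 4 1 8 7 6.
  normalForm : Sign → Sign → Fin 10 → Sign
  normalForm p q = lookup
    (pos ∷ pos ∷ pos ∷ pos ∷ pos ∷ p ∷ pos ∷ pos ∷ pos ∷ q ∷ [])

  adjacency : Sign → Sign → Matrix 9 9
  adjacency p q = adjMatrix theta535 (normalForm p q)

  rows₇ : Fin 7 → Fin 9
  rows₇ = lookup (# 0 ∷ # 1 ∷ # 2 ∷ # 3 ∷ # 4 ∷ # 5 ∷ # 6 ∷ [])

  rightInverse₇ : Matrix 9 7
  rightInverse₇ = matrix
    ( ( 0ℚ ∷  0ℚ ∷   ½ ∷  0ℚ ∷  -½ ∷   ½ ∷  0ℚ ∷ []) ∷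
      ( 0ℚ ∷  0ℚ ∷  -½ ∷  0ℚ ∷   ½ ∷   ½ ∷  0ℚ ∷ []) ∷
      (  ½ ∷  -½ ∷  0ℚ ∷   ½ ∷  0ℚ ∷  0ℚ ∷  0ℚ ∷ []) ∷
      ( 0ℚ ∷  0ℚ ∷   ½ ∷  0ℚ ∷   ½ ∷  -½ ∷  0ℚ ∷ []) ∷
      ( -½ ∷   ½ ∷  0ℚ ∷   ½ ∷  0ℚ ∷  0ℚ ∷  0ℚ ∷ []) ∷
      (  ½ ∷   ½ ∷  0ℚ ∷  -½ ∷  0ℚ ∷  0ℚ ∷  0ℚ ∷ []) ∷
      ( 0ℚ ∷  0ℚ ∷  0ℚ ∷  0ℚ ∷  0ℚ ∷  0ℚ ∷  0ℚ ∷ []) ∷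
      ( 0ℚ ∷  0ℚ ∷  -½ ∷  0ℚ ∷   ½ ∷  -½ ∷  1ℚ ∷ []) ∷
      ( 0ℚ ∷  0ℚ ∷  0ℚ ∷  0ℚ ∷  0ℚ ∷  0ℚ ∷  0ℚ ∷ []) ∷
      [])

  rows₆ : Fin 6 → Fin 9
  rows₆ = lookup (# 0 ∷ # 1 ∷ # 2 ∷ # 3 ∷ # 4 ∷ # 6 ∷ [])

  rightInverse₆ : Matrix 9 6
  rightInverse₆ = matrix
    ( ( 0ℚ ∷  0ℚ ∷  0ℚ ∷  0ℚ ∷  0ℚ ∷  1ℚ ∷ []) ∷
      ( 0ℚ ∷  0ℚ ∷ -1ℚ ∷  0ℚ ∷  1ℚ ∷  1ℚ ∷ []) ∷
      ( 0ℚ ∷ -1ℚ ∷  0ℚ ∷  1ℚ ∷  0ℚ ∷  0ℚ ∷ []) ∷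
      ( 0ℚ ∷  0ℚ ∷  1ℚ ∷  0ℚ ∷  0ℚ ∷ -1ℚ ∷ []) ∷
      ( 0ℚ ∷  1ℚ ∷  0ℚ ∷  0ℚ ∷  0ℚ ∷  0ℚ ∷ []) ∷
      ( 0ℚ ∷  0ℚ ∷  0ℚ ∷  0ℚ ∷  0ℚ ∷  0ℚ ∷ []) ∷
      ( 1ℚ ∷  1ℚ ∷  0ℚ ∷ -1ℚ ∷  0ℚ ∷  0ℚ ∷ []) ∷
      ( 0ℚ ∷  0ℚ ∷  0ℚ ∷  0ℚ ∷  0ℚ ∷  0ℚ ∷ []) ∷
      ( 0ℚ ∷  0ℚ ∷  0ℚ ∷  0ℚ ∷  0ℚ ∷  0ℚ ∷ []) ∷
      [])

  coefficients₆ : Matrix 9 6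
  coefficients₆ = matrix
    ( ( 1ℚ ∷  0ℚ ∷  0ℚ ∷  0ℚ ∷  0ℚ ∷  0ℚ ∷ []) ∷
      ( 0ℚ ∷  1ℚ ∷  0ℚ ∷  0ℚ ∷  0ℚ ∷  0ℚ ∷ []) ∷
      ( 0ℚ ∷  0ℚ ∷  1ℚ ∷  0ℚ ∷  0ℚ ∷  0ℚ ∷ []) ∷
      ( 0ℚ ∷  0ℚ ∷  0ℚ ∷  1ℚ ∷  0ℚ ∷  0ℚ ∷ []) ∷
      ( 0ℚ ∷  0ℚ ∷  0ℚ ∷  0ℚ ∷  1ℚ ∷  0ℚ ∷ []) ∷
      ( 0ℚ ∷  0ℚ ∷  1ℚ ∷  0ℚ ∷ -1ℚ ∷  0ℚ ∷ []) ∷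
      ( 0ℚ ∷  0ℚ ∷  0ℚ ∷  0ℚ ∷  0ℚ ∷  1ℚ ∷ []) ∷
      ( 1ℚ ∷  1ℚ ∷  0ℚ ∷ -1ℚ ∷  0ℚ ∷  0ℚ ∷ []) ∷
      ( 0ℚ ∷  0ℚ ∷ -1ℚ ∷  0ℚ ∷  1ℚ ∷  1ℚ ∷ []) ∷
      [])

  rows₇′ : Fin 7 → Fin 9
  rows₇′ = lookup (# 0 ∷ # 1 ∷ # 2 ∷ # 3 ∷ # 4 ∷ # 6 ∷ # 7 ∷ [])

  rightInverse₇′ : Matrix 9 7
  rightInverse₇′ = matrix
    ( ( 0ℚ ∷  0ℚ ∷  0ℚ ∷  0ℚ ∷  0ℚ ∷  1ℚ ∷  0ℚ ∷ []) ∷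
      ( 0ℚ ∷  0ℚ ∷ -1ℚ ∷  0ℚ ∷  1ℚ ∷  1ℚ ∷  0ℚ ∷ []) ∷
      (  ½ ∷  -½ ∷  0ℚ ∷   ½ ∷  0ℚ ∷  0ℚ ∷  -½ ∷ []) ∷
      ( 0ℚ ∷  0ℚ ∷  1ℚ ∷  0ℚ ∷  0ℚ ∷ -1ℚ ∷  0ℚ ∷ []) ∷
      ( -½ ∷   ½ ∷  0ℚ ∷   ½ ∷  0ℚ ∷  0ℚ ∷   ½ ∷ []) ∷
      ( 0ℚ ∷  0ℚ ∷  0ℚ ∷  0ℚ ∷  0ℚ ∷  0ℚ ∷  0ℚ ∷ []) ∷
      (  ½ ∷   ½ ∷  0ℚ ∷  -½ ∷  0ℚ ∷  0ℚ ∷   ½ ∷ []) ∷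
      ( 0ℚ ∷  0ℚ ∷  0ℚ ∷  0ℚ ∷  0ℚ ∷  0ℚ ∷  0ℚ ∷ []) ∷
      ( -½ ∷  -½ ∷  0ℚ ∷   ½ ∷  0ℚ ∷  0ℚ ∷   ½ ∷ []) ∷
      [])

  hexagon hexagon′ : Fin 6 → Fin 9
  hexagon  = lookup (# 0 ∷ # 2 ∷ # 3 ∷ # 4 ∷ # 1 ∷ # 5 ∷ [])
  hexagon′ = lookup (# 0 ∷ # 5 ∷ # 1 ∷ # 8 ∷ # 7 ∷ # 6 ∷ [])

  rank6⇔hexagonsNegative-normalForm : ∀ p q →
    HasRank (adjacency p q) 6 ⇔ AllCyclesOfLengthNegative theta535 (normalForm p q) 6
  rank6⇔hexagonsNegative-normalForm pos pos = ⇔-both-false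
    (¬hasRank-by (adjacency pos pos) rows₇ rightInverse₇)
    (¬allCyclesNegative-by theta535 (normalForm pos pos) hexagon)
  rank6⇔hexagonsNegative-normalForm pos neg = ⇔-both-false
    (¬hasRank-by (adjacency pos neg) rows₇ rightInverse₇)
    (¬allCyclesNegative-by theta535 (normalForm pos neg) hexagon)
  rank6⇔hexagonsNegative-normalForm neg pos = mk⇔
    (λ _ → allCyclesNegative-by theta535 (normalForm neg pos))
    (λ _ → hasRank-by (adjacency neg pos) rows₆ rightInverse₆ coefficients₆)
  rank6⇔hexagonsNegative-normalForm neg neg = ⇔-both-false
    (¬hasRank-by (adjacency neg neg) rows₇′ rightInverse₇′)
    (¬allCyclesNegative-by theta535 (normalForm neg neg) hexagon′)

  rank6⇔hexagonsNegative : (σ : Fin 10 → Sign) →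
    HasRank (adjMatrix theta535 σ) 6 ⇔ AllCyclesOfLengthNegative theta535 σ 6
  rank6⇔hexagonsNegative σ =
    ⇔-trans (hasRank-switch switches)
      (⇔-trans (rank6⇔hexagonsNegative-normalForm p q) (⇔-sym (allCyclesNegative-switch switches)))
    where
      open SpanningTree theta535 parent
      p = normalise σ (# 5)
      q = normalise σ (# 9)
      switches : Switches theta535 (potential σ) σ (normalForm p q)
      switches = normalForm-switches σ (normalForm p q) refl

module Theta555 where

  parent : Fin 11 → Maybe (Fin 12)
  parent = lookup
    ( nothing ∷ just (# 3) ∷ just (# 0) ∷ just (# 1) ∷ just (# 2) ∷ just (# 4) ∷
      just (# 5) ∷ just (# 6) ∷ just (# 8) ∷ just (# 9) ∷ just (# 10) ∷ [])

  -- p and q are the signs of the cycles 0 2 3 4 1 7 6 5 and 0 2 3 4 1 10 9 8.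
  normalForm : Sign → Sign → Fin 12 → Sign
  normalForm p q = lookup
    (pos ∷ pos ∷ pos ∷ pos ∷ pos ∷ pos ∷ pos ∷ p ∷ pos ∷ pos ∷ pos ∷ q ∷ [])

  adjacency : Sign → Sign → Matrix 11 11
  adjacency p q = adjMatrix theta555 (normalForm p q)

  rows₈ : Fin 8 → Fin 11
  rows₈ = lookup (# 0 ∷ # 1 ∷ # 2 ∷ # 3 ∷ # 4 ∷ # 5 ∷ # 6 ∷ # 8 ∷ [])

  rightInverse₈ : Matrix 11 8
  rightInverse₈ = matrix
    ( ( 0ℚ ∷  0ℚ ∷  0ℚ ∷  0ℚ ∷  0ℚ ∷  0ℚ ∷  0ℚ ∷  1ℚ ∷ []) ∷
      ( 0ℚ ∷  0ℚ ∷ -1ℚ ∷  0ℚ ∷  1ℚ ∷  0ℚ ∷  0ℚ ∷  1ℚ ∷ []) ∷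
      ( 0ℚ ∷ -1ℚ ∷  0ℚ ∷  1ℚ ∷  0ℚ ∷  0ℚ ∷  0ℚ ∷  0ℚ ∷ []) ∷
      ( 0ℚ ∷  0ℚ ∷  1ℚ ∷  0ℚ ∷  0ℚ ∷  0ℚ ∷  0ℚ ∷ -1ℚ ∷ []) ∷
      ( 0ℚ ∷  1ℚ ∷  0ℚ ∷  0ℚ ∷  0ℚ ∷  0ℚ ∷  0ℚ ∷  0ℚ ∷ []) ∷
      ( 0ℚ ∷  0ℚ ∷  0ℚ ∷  0ℚ ∷  0ℚ ∷  0ℚ ∷  1ℚ ∷  0ℚ ∷ []) ∷
      ( 0ℚ ∷  0ℚ ∷  0ℚ ∷  0ℚ ∷  0ℚ ∷  1ℚ ∷  0ℚ ∷ -1ℚ ∷ []) ∷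
      ( 0ℚ ∷  0ℚ ∷  0ℚ ∷  0ℚ ∷  0ℚ ∷  0ℚ ∷  0ℚ ∷  0ℚ ∷ []) ∷
      ( 1ℚ ∷  1ℚ ∷  0ℚ ∷ -1ℚ ∷  0ℚ ∷  0ℚ ∷ -1ℚ ∷  0ℚ ∷ []) ∷
      ( 0ℚ ∷  0ℚ ∷  0ℚ ∷  0ℚ ∷  0ℚ ∷  0ℚ ∷  0ℚ ∷  0ℚ ∷ []) ∷
      ( 0ℚ ∷  0ℚ ∷  0ℚ ∷  0ℚ ∷  0ℚ ∷  0ℚ ∷  0ℚ ∷  0ℚ ∷ []) ∷
      [])

  coefficients₈ : Matrix 11 8
  coefficients₈ = matrix
    ( ( 1ℚ ∷  0ℚ ∷  0ℚ ∷  0ℚ ∷  0ℚ ∷  0ℚ ∷  0ℚ ∷  0ℚ ∷ []) ∷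
      ( 0ℚ ∷  1ℚ ∷  0ℚ ∷  0ℚ ∷  0ℚ ∷  0ℚ ∷  0ℚ ∷  0ℚ ∷ []) ∷
      ( 0ℚ ∷  0ℚ ∷  1ℚ ∷  0ℚ ∷  0ℚ ∷  0ℚ ∷  0ℚ ∷  0ℚ ∷ []) ∷
      ( 0ℚ ∷  0ℚ ∷  0ℚ ∷  1ℚ ∷  0ℚ ∷  0ℚ ∷  0ℚ ∷  0ℚ ∷ []) ∷
      ( 0ℚ ∷  0ℚ ∷  0ℚ ∷  0ℚ ∷  1ℚ ∷  0ℚ ∷  0ℚ ∷  0ℚ ∷ []) ∷
      ( 0ℚ ∷  0ℚ ∷  0ℚ ∷  0ℚ ∷  0ℚ ∷  1ℚ ∷  0ℚ ∷  0ℚ ∷ []) ∷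
      ( 0ℚ ∷  0ℚ ∷  0ℚ ∷  0ℚ ∷  0ℚ ∷  0ℚ ∷  1ℚ ∷  0ℚ ∷ []) ∷
      ( 0ℚ ∷  0ℚ ∷ -1ℚ ∷  0ℚ ∷  1ℚ ∷  1ℚ ∷  0ℚ ∷  0ℚ ∷ []) ∷
      ( 0ℚ ∷  0ℚ ∷  0ℚ ∷  0ℚ ∷  0ℚ ∷  0ℚ ∷  0ℚ ∷  1ℚ ∷ []) ∷
      ( 1ℚ ∷  1ℚ ∷  0ℚ ∷ -1ℚ ∷  0ℚ ∷  0ℚ ∷ -1ℚ ∷  0ℚ ∷ []) ∷
      ( 0ℚ ∷  0ℚ ∷ -1ℚ ∷  0ℚ ∷  1ℚ ∷  0ℚ ∷  0ℚ ∷  1ℚ ∷ []) ∷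
      [])

  rows₉ : Fin 9 → Fin 11
  rows₉ = lookup (# 0 ∷ # 1 ∷ # 2 ∷ # 3 ∷ # 4 ∷ # 5 ∷ # 6 ∷ # 8 ∷ # 9 ∷ [])

  rightInverse₉ : Matrix 11 9
  rightInverse₉ = matrix
    ( ( 0ℚ ∷  0ℚ ∷  0ℚ ∷  0ℚ ∷  0ℚ ∷  0ℚ ∷  0ℚ ∷  1ℚ ∷  0ℚ ∷ []) ∷
      ( 0ℚ ∷  0ℚ ∷ -1ℚ ∷  0ℚ ∷  1ℚ ∷  0ℚ ∷  0ℚ ∷  1ℚ ∷  0ℚ ∷ []) ∷
      (  ½ ∷  -½ ∷  0ℚ ∷   ½ ∷  0ℚ ∷  0ℚ ∷  -½ ∷  0ℚ ∷  -½ ∷ []) ∷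
      ( 0ℚ ∷  0ℚ ∷  1ℚ ∷  0ℚ ∷  0ℚ ∷  0ℚ ∷  0ℚ ∷ -1ℚ ∷  0ℚ ∷ []) ∷
      ( -½ ∷   ½ ∷  0ℚ ∷   ½ ∷  0ℚ ∷  0ℚ ∷   ½ ∷  0ℚ ∷   ½ ∷ []) ∷
      ( 0ℚ ∷  0ℚ ∷  0ℚ ∷  0ℚ ∷  0ℚ ∷  0ℚ ∷  1ℚ ∷  0ℚ ∷  0ℚ ∷ []) ∷
      ( 0ℚ ∷  0ℚ ∷  0ℚ ∷  0ℚ ∷  0ℚ ∷  1ℚ ∷  0ℚ ∷ -1ℚ ∷  0ℚ ∷ []) ∷
      ( 0ℚ ∷  0ℚ ∷  0ℚ ∷  0ℚ ∷  0ℚ ∷  0ℚ ∷  0ℚ ∷  0ℚ ∷  0ℚ ∷ []) ∷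
      (  ½ ∷   ½ ∷  0ℚ ∷  -½ ∷  0ℚ ∷  0ℚ ∷  -½ ∷  0ℚ ∷   ½ ∷ []) ∷
      ( 0ℚ ∷  0ℚ ∷  0ℚ ∷  0ℚ ∷  0ℚ ∷  0ℚ ∷  0ℚ ∷  0ℚ ∷  0ℚ ∷ []) ∷
      ( -½ ∷  -½ ∷  0ℚ ∷   ½ ∷  0ℚ ∷  0ℚ ∷   ½ ∷  0ℚ ∷   ½ ∷ []) ∷
      [])

  rows₉′ : Fin 9 → Fin 11
  rows₉′ = lookup (# 0 ∷ # 1 ∷ # 2 ∷ # 3 ∷ # 4 ∷ # 5 ∷ # 6 ∷ # 7 ∷ # 8 ∷ [])

  rightInverse₉′ : Matrix 11 9
  rightInverse₉′ = matrix
    ( ( 0ℚ ∷  0ℚ ∷   ½ ∷  0ℚ ∷  -½ ∷   ½ ∷  0ℚ ∷  -½ ∷  0ℚ ∷ []) ∷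
      ( 0ℚ ∷  0ℚ ∷  -½ ∷  0ℚ ∷   ½ ∷   ½ ∷  0ℚ ∷  -½ ∷  0ℚ ∷ []) ∷
      (  ½ ∷  -½ ∷  0ℚ ∷   ½ ∷  0ℚ ∷  0ℚ ∷  -½ ∷  0ℚ ∷  0ℚ ∷ []) ∷
      ( 0ℚ ∷  0ℚ ∷   ½ ∷  0ℚ ∷   ½ ∷  -½ ∷  0ℚ ∷   ½ ∷  0ℚ ∷ []) ∷
      ( -½ ∷   ½ ∷  0ℚ ∷   ½ ∷  0ℚ ∷  0ℚ ∷   ½ ∷  0ℚ ∷  0ℚ ∷ []) ∷
      (  ½ ∷   ½ ∷  0ℚ ∷  -½ ∷  0ℚ ∷  0ℚ ∷   ½ ∷  0ℚ ∷  0ℚ ∷ []) ∷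
      ( 0ℚ ∷  0ℚ ∷  -½ ∷  0ℚ ∷   ½ ∷   ½ ∷  0ℚ ∷   ½ ∷  0ℚ ∷ []) ∷
      ( -½ ∷  -½ ∷  0ℚ ∷   ½ ∷  0ℚ ∷  0ℚ ∷   ½ ∷  0ℚ ∷  0ℚ ∷ []) ∷
      ( 0ℚ ∷  0ℚ ∷  0ℚ ∷  0ℚ ∷  0ℚ ∷  0ℚ ∷  0ℚ ∷  0ℚ ∷  0ℚ ∷ []) ∷
      ( 0ℚ ∷  0ℚ ∷  -½ ∷  0ℚ ∷   ½ ∷  -½ ∷  0ℚ ∷   ½ ∷  1ℚ ∷ []) ∷
      ( 0ℚ ∷  0ℚ ∷  0ℚ ∷  0ℚ ∷  0ℚ ∷  0ℚ ∷  0ℚ ∷  0ℚ ∷  0ℚ ∷ []) ∷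
      [])

  octagon octagon′ : Fin 8 → Fin 11
  octagon  = lookup (# 0 ∷ # 2 ∷ # 3 ∷ # 4 ∷ # 1 ∷ # 7 ∷ # 6 ∷ # 5 ∷ [])
  octagon′ = lookup (# 0 ∷ # 2 ∷ # 3 ∷ # 4 ∷ # 1 ∷ # 10 ∷ # 9 ∷ # 8 ∷ [])

  rank8⇔balanced-normalForm : ∀ p q → HasRank (adjacency p q) 8 ⇔ Balanced theta555 (normalForm p q)
  rank8⇔balanced-normalForm pos pos = mk⇔
    (λ _ → balanced-allPositive (λ e → lookup-replicate e pos))
    (λ _ → hasRank-by (adjacency pos pos) rows₈ rightInverse₈ coefficients₈)
  rank8⇔balanced-normalForm pos neg = ⇔-both-false
    (¬hasRank-by (adjacency pos neg) rows₉ rightInverse₉)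
    (¬balanced-by theta555 (normalForm pos neg) octagon′)
  rank8⇔balanced-normalForm neg pos = ⇔-both-false
    (¬hasRank-by (adjacency neg pos) rows₉′ rightInverse₉′)
    (¬balanced-by theta555 (normalForm neg pos) octagon)
  rank8⇔balanced-normalForm neg neg = ⇔-both-false
    (¬hasRank-by (adjacency neg neg) rows₉′ rightInverse₉′)
    (¬balanced-by theta555 (normalForm neg neg) octagon)

  rank8⇔balanced : (σ : Fin 12 → Sign) → HasRank (adjMatrix theta555 σ) 8 ⇔ Balanced theta555 σ
  rank8⇔balanced σ =
    ⇔-trans (hasRank-switch switches)
      (⇔-trans (rank8⇔balanced-normalForm p q) (⇔-sym (balanced-switch switches)))
    where
      open SpanningTree theta555 parent
      p = normalise σ (# 7)
      q = normalise σ (# 11)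
      switches : Switches theta555 (potential σ) σ (normalForm p q)
      switches = normalForm-switches σ (normalForm p q) refl

module T₁ where

  parent : Fin 10 → Maybe (Fin 12)
  parent = lookup
    ( just (# 9) ∷ just (# 0) ∷ just (# 1) ∷ just (# 2) ∷ just (# 3) ∷ just (# 4) ∷
      nothing ∷ just (# 6) ∷ just (# 7) ∷ just (# 8) ∷ [])

  -- p, q and r are the signs of the cycles 0 1 2 3 4 5, 6 7 0 1 2 8 and 6 7 0 1 2 3 4 9.
  normalForm : Sign → Sign → Sign → Fin 12 → Sign
  normalForm p q r = lookup
    (pos ∷ pos ∷ pos ∷ pos ∷ pos ∷ p ∷ pos ∷ pos ∷ pos ∷ pos ∷ q ∷ r ∷ [])

  adjacency : Sign → Sign → Sign → Matrix 10 10
  adjacency p q r = adjMatrix T1 (normalForm p q r)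

  rows₇ : Fin 7 → Fin 10
  rows₇ = lookup (# 0 ∷ # 1 ∷ # 2 ∷ # 3 ∷ # 4 ∷ # 5 ∷ # 6 ∷ [])

  rightInverse₇ : Matrix 10 7
  rightInverse₇ = matrix
    ( ( 0ℚ ∷   ½ ∷  0ℚ ∷  -½ ∷  0ℚ ∷   ½ ∷  0ℚ ∷ []) ∷
      (  ½ ∷  0ℚ ∷   ½ ∷  0ℚ ∷  -½ ∷  0ℚ ∷  -½ ∷ []) ∷
      ( 0ℚ ∷   ½ ∷  0ℚ ∷   ½ ∷  0ℚ ∷  -½ ∷  0ℚ ∷ []) ∷
      ( -½ ∷  0ℚ ∷   ½ ∷  0ℚ ∷   ½ ∷  0ℚ ∷   ½ ∷ []) ∷
      ( 0ℚ ∷  -½ ∷  0ℚ ∷   ½ ∷  0ℚ ∷   ½ ∷  0ℚ ∷ []) ∷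
      (  ½ ∷  0ℚ ∷  -½ ∷  0ℚ ∷   ½ ∷  0ℚ ∷  -½ ∷ []) ∷
      ( 0ℚ ∷  0ℚ ∷  0ℚ ∷  0ℚ ∷  0ℚ ∷  0ℚ ∷  0ℚ ∷ []) ∷
      ( 0ℚ ∷  0ℚ ∷  0ℚ ∷  0ℚ ∷  0ℚ ∷  0ℚ ∷  1ℚ ∷ []) ∷
      ( 0ℚ ∷  0ℚ ∷  0ℚ ∷  0ℚ ∷  0ℚ ∷  0ℚ ∷  0ℚ ∷ []) ∷
      ( 0ℚ ∷  0ℚ ∷  0ℚ ∷  0ℚ ∷  0ℚ ∷  0ℚ ∷  0ℚ ∷ []) ∷
      [])

  rows₇′ : Fin 7 → Fin 10
  rows₇′ = lookup (# 0 ∷ # 1 ∷ # 2 ∷ # 3 ∷ # 4 ∷ # 6 ∷ # 7 ∷ [])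

  rightInverse₇′ : Matrix 10 7
  rightInverse₇′ = matrix
    ( ( 0ℚ ∷  0ℚ ∷  0ℚ ∷  0ℚ ∷  0ℚ ∷  0ℚ ∷  1ℚ ∷ []) ∷
      (  ½ ∷  0ℚ ∷   ½ ∷  0ℚ ∷  -½ ∷  -½ ∷  0ℚ ∷ []) ∷
      ( 0ℚ ∷  1ℚ ∷  0ℚ ∷  0ℚ ∷  0ℚ ∷  0ℚ ∷ -1ℚ ∷ []) ∷
      ( 0ℚ ∷  0ℚ ∷  0ℚ ∷  0ℚ ∷  1ℚ ∷  0ℚ ∷  0ℚ ∷ []) ∷
      ( 0ℚ ∷ -1ℚ ∷  0ℚ ∷  1ℚ ∷  0ℚ ∷  0ℚ ∷  1ℚ ∷ []) ∷
      ( 0ℚ ∷  0ℚ ∷  0ℚ ∷  0ℚ ∷  0ℚ ∷  0ℚ ∷  0ℚ ∷ []) ∷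
      ( 0ℚ ∷  0ℚ ∷  0ℚ ∷  0ℚ ∷  0ℚ ∷  0ℚ ∷  0ℚ ∷ []) ∷
      (  ½ ∷  0ℚ ∷  -½ ∷  0ℚ ∷   ½ ∷   ½ ∷  0ℚ ∷ []) ∷
      ( -½ ∷  0ℚ ∷   ½ ∷  0ℚ ∷  -½ ∷   ½ ∷  0ℚ ∷ []) ∷
      ( 0ℚ ∷  0ℚ ∷  0ℚ ∷  0ℚ ∷  0ℚ ∷  0ℚ ∷  0ℚ ∷ []) ∷
      [])

  rightInverse₇″ : Matrix 10 7
  rightInverse₇″ = matrix
    ( ( 0ℚ ∷  0ℚ ∷  0ℚ ∷  0ℚ ∷  0ℚ ∷  0ℚ ∷  1ℚ ∷ []) ∷
      (  ½ ∷  0ℚ ∷   ½ ∷  0ℚ ∷  -½ ∷  -½ ∷  0ℚ ∷ []) ∷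
      ( 0ℚ ∷  1ℚ ∷  0ℚ ∷  0ℚ ∷  0ℚ ∷  0ℚ ∷ -1ℚ ∷ []) ∷
      ( -½ ∷  0ℚ ∷   ½ ∷  0ℚ ∷   ½ ∷   ½ ∷  0ℚ ∷ []) ∷
      ( 0ℚ ∷ -1ℚ ∷  0ℚ ∷  1ℚ ∷  0ℚ ∷  0ℚ ∷  1ℚ ∷ []) ∷
      ( 0ℚ ∷  0ℚ ∷  0ℚ ∷  0ℚ ∷  0ℚ ∷  0ℚ ∷  0ℚ ∷ []) ∷
      ( 0ℚ ∷  0ℚ ∷  0ℚ ∷  0ℚ ∷  0ℚ ∷  0ℚ ∷  0ℚ ∷ []) ∷
      (  ½ ∷  0ℚ ∷  -½ ∷  0ℚ ∷   ½ ∷   ½ ∷  0ℚ ∷ []) ∷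
      ( 0ℚ ∷  0ℚ ∷  0ℚ ∷  0ℚ ∷  0ℚ ∷  0ℚ ∷  0ℚ ∷ []) ∷
      ( -½ ∷  0ℚ ∷   ½ ∷  0ℚ ∷  -½ ∷   ½ ∷  0ℚ ∷ []) ∷
      [])

  rows₆ : Fin 6 → Fin 10
  rows₆ = lookup (# 0 ∷ # 1 ∷ # 2 ∷ # 3 ∷ # 4 ∷ # 7 ∷ [])

  rightInverse₆ : Matrix 10 6
  rightInverse₆ = matrix
    ( ( 0ℚ ∷  0ℚ ∷  0ℚ ∷  0ℚ ∷  0ℚ ∷  1ℚ ∷ []) ∷
      ( 0ℚ ∷  0ℚ ∷  1ℚ ∷  0ℚ ∷ -1ℚ ∷  0ℚ ∷ []) ∷
      ( 0ℚ ∷  1ℚ ∷  0ℚ ∷  0ℚ ∷  0ℚ ∷ -1ℚ ∷ []) ∷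
      ( 0ℚ ∷  0ℚ ∷  0ℚ ∷  0ℚ ∷  1ℚ ∷  0ℚ ∷ []) ∷
      ( 0ℚ ∷ -1ℚ ∷  0ℚ ∷  1ℚ ∷  0ℚ ∷  1ℚ ∷ []) ∷
      ( 0ℚ ∷  0ℚ ∷  0ℚ ∷  0ℚ ∷  0ℚ ∷  0ℚ ∷ []) ∷
      ( 0ℚ ∷  0ℚ ∷  0ℚ ∷  0ℚ ∷  0ℚ ∷  0ℚ ∷ []) ∷
      ( 1ℚ ∷  0ℚ ∷ -1ℚ ∷  0ℚ ∷  1ℚ ∷  0ℚ ∷ []) ∷
      ( 0ℚ ∷  0ℚ ∷  0ℚ ∷  0ℚ ∷  0ℚ ∷  0ℚ ∷ []) ∷
      ( 0ℚ ∷  0ℚ ∷  0ℚ ∷  0ℚ ∷  0ℚ ∷  0ℚ ∷ []) ∷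
      [])

  coefficients₆ : Matrix 10 6
  coefficients₆ = matrix
    ( ( 1ℚ ∷  0ℚ ∷  0ℚ ∷  0ℚ ∷  0ℚ ∷  0ℚ ∷ []) ∷
      ( 0ℚ ∷  1ℚ ∷  0ℚ ∷  0ℚ ∷  0ℚ ∷  0ℚ ∷ []) ∷
      ( 0ℚ ∷  0ℚ ∷  1ℚ ∷  0ℚ ∷  0ℚ ∷  0ℚ ∷ []) ∷
      ( 0ℚ ∷  0ℚ ∷  0ℚ ∷  1ℚ ∷  0ℚ ∷  0ℚ ∷ []) ∷
      ( 0ℚ ∷  0ℚ ∷  0ℚ ∷  0ℚ ∷  1ℚ ∷  0ℚ ∷ []) ∷
      ( 0ℚ ∷ -1ℚ ∷  0ℚ ∷  1ℚ ∷  0ℚ ∷  0ℚ ∷ []) ∷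
      ( 1ℚ ∷  0ℚ ∷ -1ℚ ∷  0ℚ ∷  1ℚ ∷  0ℚ ∷ []) ∷
      ( 0ℚ ∷  0ℚ ∷  0ℚ ∷  0ℚ ∷  0ℚ ∷  1ℚ ∷ []) ∷
      ( 0ℚ ∷ -1ℚ ∷  0ℚ ∷  0ℚ ∷  0ℚ ∷  1ℚ ∷ []) ∷
      ( 0ℚ ∷ -1ℚ ∷  0ℚ ∷  1ℚ ∷  0ℚ ∷  1ℚ ∷ []) ∷
      [])

  hexagon hexagon′ hexagon″ : Fin 6 → Fin 10
  hexagon  = lookup (# 0 ∷ # 1 ∷ # 2 ∷ # 3 ∷ # 4 ∷ # 5 ∷ [])
  hexagon′ = lookup (# 6 ∷ # 7 ∷ # 0 ∷ # 1 ∷ # 2 ∷ # 8 ∷ [])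
  hexagon″ = lookup (# 6 ∷ # 8 ∷ # 2 ∷ # 3 ∷ # 4 ∷ # 9 ∷ [])

  rank6⇔hexagonsNegative-normalForm : ∀ p q r →
    HasRank (adjacency p q r) 6 ⇔ AllCyclesOfLengthNegative T1 (normalForm p q r) 6
  rank6⇔hexagonsNegative-normalForm pos pos pos = ⇔-both-false
    (¬hasRank-by (adjacency pos pos pos) rows₇ rightInverse₇)
    (¬allCyclesNegative-by T1 (normalForm pos pos pos) hexagon)
  rank6⇔hexagonsNegative-normalForm pos pos neg = ⇔-both-false
    (¬hasRank-by (adjacency pos pos neg) rows₇ rightInverse₇)
    (¬allCyclesNegative-by T1 (normalForm pos pos neg) hexagon)
  rank6⇔hexagonsNegative-normalForm pos neg pos = ⇔-both-false
    (¬hasRank-by (adjacency pos neg pos) rows₇ rightInverse₇)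
    (¬allCyclesNegative-by T1 (normalForm pos neg pos) hexagon)
  rank6⇔hexagonsNegative-normalForm pos neg neg = ⇔-both-false
    (¬hasRank-by (adjacency pos neg neg) rows₇ rightInverse₇)
    (¬allCyclesNegative-by T1 (normalForm pos neg neg) hexagon)
  rank6⇔hexagonsNegative-normalForm neg pos pos = ⇔-both-false
    (¬hasRank-by (adjacency neg pos pos) rows₇′ rightInverse₇′)
    (¬allCyclesNegative-by T1 (normalForm neg pos pos) hexagon′)
  rank6⇔hexagonsNegative-normalForm neg pos neg = ⇔-both-false
    (¬hasRank-by (adjacency neg pos neg) rows₇′ rightInverse₇′)
    (¬allCyclesNegative-by T1 (normalForm neg pos neg) hexagon′)
  rank6⇔hexagonsNegative-normalForm neg neg pos = mk⇔
    (λ _ → allCyclesNegative-by T1 (normalForm neg neg pos))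
    (λ _ → hasRank-by (adjacency neg neg pos) rows₆ rightInverse₆ coefficients₆)
  rank6⇔hexagonsNegative-normalForm neg neg neg = ⇔-both-false
    (¬hasRank-by (adjacency neg neg neg) rows₇′ rightInverse₇″)
    (¬allCyclesNegative-by T1 (normalForm neg neg neg) hexagon″)

  rank6⇔hexagonsNegative : (σ : Fin 12 → Sign) →
    HasRank (adjMatrix T1 σ) 6 ⇔ AllCyclesOfLengthNegative T1 σ 6
  rank6⇔hexagonsNegative σ =
    ⇔-trans (hasRank-switch switches)
      (⇔-trans (rank6⇔hexagonsNegative-normalForm p q r) (⇔-sym (allCyclesNegative-switch switches)))
    where
      open SpanningTree T1 parent
      p = normalise σ (# 5)
      q = normalise σ (# 10)
      r = normalise σ (# 11)
      switches : Switches T1 (potential σ) σ (normalForm p q r)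
      switches = normalForm-switches σ (normalForm p q r) refl

lemma3p6 :
    ((σ : Fin 10 → Sign) →
      HasRank (adjMatrix theta535 σ) 6 ⇔ AllCyclesOfLengthNegative theta535 σ 6)
    × ((σ : Fin 12 → Sign) →
      HasRank (adjMatrix theta555 σ) 8 ⇔ Balanced theta555 σ)
    × ((σ : Fin 12 → Sign) →
      HasRank (adjMatrix T1 σ) 6 ⇔ AllCyclesOfLengthNegative T1 σ 6)
lemma3p6 = Theta535.rank6⇔hexagonsNegative , Theta555.rank8⇔balanced , T₁.rank6⇔hexagonsNegative
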